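{- For every predicate map $\Pi$, every product state $s$ of $\mathcal A^e\times\overline B$ and every configuration $(\vec q,P,\nu)\in\mathit{succ}_{\mathcal A^e\times\overline B}([\![s]\!])$, there exists a product state $t\in\mathit{Post}_\Pi(s)$ such that $(\vec q,P,\nu)\in[\![t]\!]$.
   Context: Data automata (DA): $\mathcal{D}$ is a data domain with first-order theory $\mathrm{Th}(\mathcal D)$ closed under conjunction and negation; a DA $\langle\mathcal D,\Sigma,\vec x,Q,\iota,F,\Delta\rangle$ has finite alphabet, finite variables $\vec x$, finite states, initial $\iota$, final $F$, rules $q\xrightarrow{\sigma,\phi(\vec x,\vec x')}q'$ with $\phi\in\mathrm{Th}(\mathcal D)$. A configuration $(q',\nu')$ is a successor of $(q,\nu)$ if some rule $q\xrightarrow{\sigma,\phi}q'$ has $(\nu,\nu')\models\phi$; for a set $C$ of configurations, $\mathit{succ}(C)$ is the set of successors of its elements. Network $\mathcal A=\langle A_1,\dots,A_N\rangle$, $A_i=\langle\mathcal D,\Sigma_i,\vec x_i,Q_i,\iota_i,F_i,\Delta_i\rangle$ with disjoint state sets; expansion $\mathcal A^e$: variables $\vec x_{\mathcal A}=\bigcup\vec x_i$, states $Q_1\times\dots\times Q_N$, rules $\langle q_1,\dots,q_N\rangle\xrightarrow{\sigma,\varphi}\langle q_1',\dots,q_N'\rangle$ where with $I$ the indices $i$ having a rule $q_i\xrightarrow{\sigma,\varphi_i}q_i'\in\Delta_i$, $q_j=q_j'$ for $j\notin I$ and $\varphi\equiv\bigwedge_{i\in I}\varphi_i\wedge\bigwedge_{j\notin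 I}\bigwedge_{x\in\vec x_j\setminus\bigcup_{i\in I}\vec x_i}x'=x$. Observer DA $B=\langle\mathcal D,\Sigma,\vec x_B,Q_B,\iota_B,F_B,\Delta_B\rangle$, $\vec x_B\subseteq\vec x_{\mathcal A}$; complement $\overline B$ with states $2^{Q_B}$, rules $P\xrightarrow{\sigma,\theta}P'$ whenever every $p'\in P'$ has a $\sigma$-rule from some $p\in P$, $\theta\equiv\bigwedge_{p'\in P'}\bigvee_{p\in P,\,p\xrightarrow{\sigma,\psi}p'\in\Delta_B}\psi\wedge\bigwedge_{p'\notin P'}\bigwedge_{p\in P,\,p\xrightarrow{\sigma,\varphi}p'\in\Delta_B}\neg\varphi$. Product $\mathcal A^e\times\overline B$: variables $\vec x_{\mathcal A}$, states $(\vec q,P)$, rules $(\vec q,P)\xrightarrow{\sigma,\varphi\wedge\theta}(\vec q',P')$ for rules $\vec q\xrightarrow{\sigma,\varphi}\vec q'$ of $\mathcal A^e$ and $P\xrightarrow{\sigma,\theta}P'$ of $\overline B$. A product state $s=(\vec q,P,\Phi)$ with $\Phi(\vec x_{\mathcal A})\in\mathrm{Th}(\mathcal D)$ denotes $[\![s]\!]=\{(\vec q,P,\nu)\mid\nu\models\Phi\}$. $\mathit{Post}(s)$ is the set of $(\vec r,S,\Psi)$ such that there is a product rule $(\vec q,P)\xrightarrow{\sigma,\theta}(\vec r,S)$ and $\Psi(\vec x_{\mathcal A})\equiv\exists\vec x'_{\mathcal A}.\,\Phi(\vec x'_{\mathcal A})\wedge\theta(\vec x'_{\mathcal A},\vec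 x_{\mathcal A})$ is satisfiable. A substate of $(\langle q_1,\dots,q_N\rangle,P)$ is $(\langle q_{i_1},\dots,q_{i_m}\rangle,S)$ with $i_1<\dots<i_m$, $S\subseteq Q_B$, and $S\neq\emptyset$ only if $S\cap P\neq\emptyset$; write $r\vartriangleleft(\vec q,P)$. A predicate map $\Pi$ assigns to each substate $(\langle q_{i_1},\dots,q_{i_m}\rangle,S)$ a set of formulae over $\vec x_{i_1}\cup\dots\cup\vec x_{i_m}$ (together with $\vec x_B$ if $S\neq\emptyset$). $\mathit{Post}_\Pi(s)$ is the set of $(\vec r,S,\Psi^\sharp)$ such that $(\vec r,S,\Psi)\in\mathit{Post}(s)$ and $\Psi^\sharp\equiv\bigwedge_{r\vartriangleleft(\vec r,S)}\bigwedge\{\pi\in\Pi(r)\mid\Psi\rightarrow\pi\text{ valid}\}$. -}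

module Defs where

open import Level using (0ℓ) renaming (suc to lsuc)
open import Data.Nat using (ℕ)
open import Data.Fin using (Fin)
open import Data.Fin.Subset using (Subset; _∈_; _∉_; _∩_; Nonempty)
open import Data.Product using (Σ; ∃; _×_; _,_; proj₁)
open import Data.Sum using (_⊎_; inj₁; inj₂)
open import Data.Unit using (⊤)
open import Data.Empty using (⊥)
open import Relation.Nullary using (¬_)
open import Relation.Binary.PropositionalEquality using (_≡_)

-- The global variable set x_𝒜 is
--    Fin n; every automaton's variable set is a (finite) subset of it.
--  * A valuation is a map  Fin n → D.
--  * Formulae of Th(D) are represented semantically: a formula over the
--    variables V is a predicate on valuations that only depends on the
--    values of the variables in V (two-vocabulary formulae φ(x,x') are
--    binary predicates on (ν , ν')).  "φ ≡ ψ" is logical equivalence,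
--    "φ valid" is truth under every valuation.
--  * The global alphabet is Fin k; each automaton has an alphabet
--    Σ ⊆ Fin k.

module _ (D : Set) (n : ℕ) where

  Val : Set
  Val = Fin n → D

  Agree : (Fin n → Set) → Val → Val → Set
  Agree V ν μ = ∀ x → V x → ν x ≡ μ x

  Over : (Fin n → Set) → (Val → Set) → Set
  Over V φ = ∀ ν μ → Agree V ν μ → φ ν → φ μ

  Over₂ : (Fin n → Set) → (Val → Val → Set) → Set
  Over₂ V φ = ∀ ν ν' μ μ' → Agree V ν μ → Agree V ν' μ' → φ ν ν' → φ μ μ'

record DA (D : Set) (n k : ℕ) : Set₁ where
  field
    alph  : Subset k
    vars  : Subset n
    nQ    : ℕ
    ι     : Fin nQ
    F     : Subset nQ
    nΔ    : ℕ
    src   : Fin nΔ → Fin nQ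
    lab   : Fin nΔ → Fin k
    tgt   : Fin nΔ → Fin nQ
    guard : Fin nΔ → Val D n → Val D n → Set
    lab∈  : ∀ r → lab r ∈ alph
    guard-over : ∀ r → Over₂ D n (λ x → x ∈ vars) (guard r)

open DA public

-- Network  ⟨A₁,…,A_N⟩ ; x⃗_𝒜 = ⋃ x⃗ᵢ = Fin n  (state sets disjoint by typing)
record Network (D : Set) (n k : ℕ) : Set₁ where
  field
    N     : ℕ
    A     : Fin N → DA D n k
    cover : ∀ (x : Fin n) → ∃ λ i → x ∈ vars (A i)

open Network public

module Product {D : Set} {n k : ℕ} (𝒜 : Network D n k) (B : DA D n k) where

  V : Set
  V = Val D n

  EState : Set
  EState = (i : Fin (N 𝒜)) → Fin (nQ (A 𝒜 i))

  -- for component i: either a rule qᵢ --σ--> q'ᵢ of Δᵢ is taken (i ∈ I),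
  -- or there is no such rule and qᵢ = q'ᵢ (i ∉ I)
  Step : Fin k → EState → EState → Fin (N 𝒜) → Set
  Step σ q q' i =
    (Σ (Fin (nΔ Aᵢ)) λ r → src Aᵢ r ≡ q i × lab Aᵢ r ≡ σ × tgt Aᵢ r ≡ q' i)
    ⊎ ((∀ r → src Aᵢ r ≡ q i → lab Aᵢ r ≡ σ → tgt Aᵢ r ≡ q' i → ⊥) × q i ≡ q' i)
    where Aᵢ = A 𝒜 i

  -- a rule  q --σ--> q'  of 𝒜ᵉ (one choice of the φᵢ, i ∈ I)
  ERule : Fin k → EState → EState → Set
  ERule σ q q' = (∃ λ i → σ ∈ alph (A 𝒜 i)) × ((i : Fin (N 𝒜)) → Step σ q q' i)

  InI : ∀ σ q q' i → Step σ q q' i → Set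
  InI _ _ _ _ (inj₁ _) = ⊤
  InI _ _ _ _ (inj₂ _) = ⊥

  guardOf : ∀ σ q q' i → Step σ q q' i → V → V → Set
  guardOf _ _ _ i (inj₁ (r , _)) ν ν' = guard (A 𝒜 i) r ν ν'
  guardOf _ _ _ _ (inj₂ _) ν ν' = ⊤

  -- φ ≡ ⋀_{i∈I} φᵢ ∧ ⋀_{j∉I} ⋀_{x ∈ x⃗ⱼ ∖ ⋃_{i∈I} x⃗ᵢ} x' = x
  EGuard : ∀ {σ q q'} → ERule σ q q' → V → V → Set
  EGuard {σ} {q} {q'} (_ , ch) ν ν' =
    (∀ i → guardOf σ q q' i (ch i) ν ν')
    × (∀ j → ¬ InI σ q q' j (ch j) → ∀ x → x ∈ vars (A 𝒜 j)
         → (∀ i → InI σ q q' i (ch i) → x ∉ vars (A 𝒜 i)) → ν' x ≡ ν x)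

  QB : ℕ
  QB = nQ B

  CRule : Fin k → Subset QB → Subset QB → Set
  CRule σ P P' = σ ∈ alph B ×
    (∀ p' → p' ∈ P' → Σ (Fin (nΔ B)) λ r → src B r ∈ P × lab B r ≡ σ × tgt B r ≡ p')

  θ : Fin k → Subset QB → Subset QB → V → V → Set
  θ σ P P' ν ν' =
    (∀ p' → p' ∈ P' → Σ (Fin (nΔ B)) λ r →
        src B r ∈ P × lab B r ≡ σ × tgt B r ≡ p' × guard B r ν ν')
    × (∀ p' → p' ∉ P' → ∀ r → src B r ∈ P → lab B r ≡ σ → tgt B r ≡ p'
         → ¬ guard B r ν ν')

  PState : Set
  PState = EState × Subset QB

  record PRule (s s' : PState) : Set where
    constructor prule
    field
      σ  : Fin k
      er : ERule σ (proj₁ s) (proj₁ s')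
      cr : CRule σ (Data.Product.proj₂ s) (Data.Product.proj₂ s')

  PGuard : ∀ {s s'} → PRule s s' → V → V → Set
  PGuard {s} {s'} (prule σ er _) ν ν' =
    EGuard er ν ν' × θ σ (Data.Product.proj₂ s) (Data.Product.proj₂ s') ν ν'

  Config : Set
  Config = PState × V

  succ : (Config → Set) → Config → Set
  succ C (s' , ν') = Σ Config λ c → C c × Σ (PRule (proj₁ c) s') λ ρ →
                       PGuard ρ (Data.Product.proj₂ c) ν'

  record ProdState : Set₁ where
    constructor pstate
    field
      st  : PState
      Φ   : V → Set

  ⟦_⟧ : ProdState → Config → Set
  ⟦ pstate s Φ ⟧ (s' , ν) = (s' ≡ s) × Φ ν

  record Substate : Set where
    constructor substate
    field
      I  : Subset (N 𝒜)
      qs : (i : Σ (Fin (N 𝒜)) λ i → i ∈ I) → Fin (nQ (A 𝒜 (proj₁ i)))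
      S  : Subset QB

  _◁_ : Substate → PState → Set
  substate I qs S ◁ (q , P) =
    (∀ i (i∈ : i ∈ I) → qs (i , i∈) ≡ q i) × (Nonempty S → Nonempty (S ∩ P))

  -- variables a formula of Π(r) may mention
  SubVars : Substate → Fin n → Set
  SubVars (substate I _ S) x =
    (Σ (Fin (N 𝒜)) λ i → i ∈ I × x ∈ vars (A 𝒜 i)) ⊎ (Nonempty S × x ∈ vars B)

  -- Π(r) is a set of formulae: an index set together with the formulae
  record PredMap : Set₁ where
    field
      Idx  : Substate → Set
      pred : (r : Substate) → Idx r → V → Set
      over : ∀ r j → Over D n (SubVars r) (pred r j)

  open PredMap public

  PostFormula : (Φ : V → Set) {s s' : PState} → PRule s s' → V → Set
  PostFormula Φ ρ ν = Σ V λ ν₀ → Φ ν₀ × PGuard ρ ν₀ ν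

  Sharp : PredMap → PState → (V → Set) → V → Set
  Sharp Π s' Ψ ν = ∀ (r : Substate) → r ◁ s' → ∀ (j : Idx Π r) →
                     (∀ μ → Ψ μ → pred Π r j μ) → pred Π r j ν

  InPostΠ : PredMap → ProdState → ProdState → Set
  InPostΠ Π (pstate s Φ) (pstate s' Ψ♯) =
    Σ (PRule s s') λ ρ →
      (∃ λ ν → PostFormula Φ ρ ν)
      × (∀ ν → (Ψ♯ ν → Sharp Π s' (PostFormula Φ ρ) ν)
             × (Sharp Π s' (PostFormula Φ ρ) ν → Ψ♯ ν))

module Submission where

-- A concrete successor (q⃗', P', ν') of a configuration (q⃗, P, ν₀) ∈ ⟦ s ⟧ is
-- reached along some product rule ρ, so ν' satisfies the exact post-image
-- Ψ ≡ ∃x⃗'. Φ(x⃗') ∧ θ(x⃗', x⃗) of s along ρ; in particular Ψ is satisfiable.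
-- The abstraction Ψ♯ is a conjunction of predicates π that Ψ implies, hence
-- Ψ → Ψ♯ for every predicate map (the abstraction over-approximates).

open import Defs
open import Data.Nat using (ℕ)
open import Data.Product using (Σ; ∃; _×_; _,_)
open import Relation.Binary.PropositionalEquality using (refl)
open import Function using (id)

module Abstraction {D : Set} {n k : ℕ} (𝒜 : Network D n k) (B : DA D n k) where

  open Product 𝒜 B

  -- Ψ♯ keeps only predicates implied by Ψ, so every model of Ψ is a model of Ψ♯.
  abstraction-over-approximates : (Π : PredMap) (s' : PState) (Ψ : V → Set)
    (ν : V) → Ψ ν → Sharp Π s' Ψ ν
  abstraction-over-approximates Π s' Ψ ν Ψν _ _ _ Ψ⇒π = Ψ⇒π ν Ψν

  successor-in-post-image : {s s' : PState} (Φ : V → Set) (ν₀ ν' : V)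
    (ρ : PRule s s') → Φ ν₀ → PGuard ρ ν₀ ν' → PostFormula Φ ρ ν'
  successor-in-post-image Φ ν₀ ν' ρ Φν₀ g = ν₀ , Φν₀ , g

  abstract-post-along : (Π : PredMap) {s s' : PState} (Φ : V → Set)
    (ρ : PRule s s') → ∃ (PostFormula Φ ρ) →
    InPostΠ Π (pstate s Φ) (pstate s' (Sharp Π s' (PostFormula Φ ρ)))
  abstract-post-along Π Φ ρ satisfiable = ρ , satisfiable , λ ν → id , id

lemma7 : {D : Set} {n k : ℕ} (𝒜 : Network D n k) (B : DA D n k)
    (Π : Product.PredMap 𝒜 B) (s : Product.ProdState 𝒜 B)
    (c : Product.Config 𝒜 B) →
    Product.succ 𝒜 B (Product.⟦_⟧ 𝒜 B s) c →
    Σ (Product.ProdState 𝒜 B) (λ t →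
    Product.InPostΠ 𝒜 B Π s t × Product.⟦_⟧ 𝒜 B t c)
lemma7 𝒜 B Π (Product.pstate st Φ) (s' , ν') ((.st , ν₀) , (refl , Φν₀) , ρ , g) =
  pstate s' Ψ♯ , abstract-post-along Π Φ ρ (ν' , Ψν') , (refl , Ψ♯ν')
  where
  open Product 𝒜 B
  open Abstraction 𝒜 B

  Ψν' : PostFormula Φ ρ ν'
  Ψν' = successor-in-post-image Φ ν₀ ν' ρ Φν₀ g

  Ψ♯ : V → Set
  Ψ♯ = Sharp Π s' (PostFormula Φ ρ)

  Ψ♯ν' : Ψ♯ ν'
  Ψ♯ν' = abstraction-over-approximates Π s' (PostFormula Φ ρ) ν' Ψν'
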